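{- Let $0\leq k\leq n$ be integers. Then $$\frac{1}{2n-1}\cdot\frac{(6k)!\,(6n-6k)!\,(2n)!}{(3k)!\,(3n-3k)!\,(3n)!\,(2k)!\,(2n-2k)!}\in\mathbb{Z},$$ i.e. $2n-1$ divides $\frac{(6k)!(6n-6k)!(2n)!}{(3k)!(3n-3k)!(3n)!(2k)!(2n-2k)!}$ in the sense that the quotient is an integer. -}

module Defs where

open import Data.Nat using (ℕ; _*_; _∸_; _!)
open import Data.Integer as ℤ using (ℤ; +_; -[1+_])

-- Numerator  (6k)! (6n-6k)! (2n)!   (for k ≤ n, 6n-6k = 6 * (n ∸ k))
numer : ℕ → ℕ → ℕ
numer n k = (6 * k) ! * (6 * (n ∸ k)) ! * (2 * n) !

denom : ℕ → ℕ → ℕ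
denom n k = (3 * k) ! * (3 * (n ∸ k)) ! * (3 * n) ! * (2 * k) ! * (2 * (n ∸ k)) !

-- The integer 2n - 1 (equal to -1 when n = 0; no truncated subtraction)
twoNMinusOne : ℕ → ℤ
twoNMinusOne n = (+ (2 * n)) ℤ.- (+ 1)

module Submission where

-- For n ≥ 1 put Y = 2n - 1 = z + 1.  Since (z+1)! = (z+1) z!, it
-- suffices that (3k)!(3m)!(3n)!(2k)!(2m)!(z+1)! divides (6k)!(6m)!(2n)!z!,
-- which by Legendre's formula (Landau's criterion) reduces, for every prime p,
-- to comparing sums over the levels Q = p^i of floor sums ⌊x / Q⌋.  At level Q
-- write K = ⌊6k/Q⌋, M = ⌊6m/Q⌋; then ⌊6n/Q⌋ = K + M + d with a carry d ≤ 1,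
-- and the excess F - D of the numerator's floor sum over the denominator's is
-- a function ("gain") of K mod 6, M mod 6 and d, which is never negative.
-- The extra denominator term ⌊(z+1)/Q⌋ - ⌊z/Q⌋ = [Q ∣ Y] is paid for by a
-- positive gain at every level Q ≥ 4 dividing Y (finite tables of residues).
-- The only defect is at Q = 3 when 3 divides k or m; there a unit of credit
-- is issued and carried up the powers of 3, where levels with 3^i ∣ k, Y have
-- larger gains, and a telescoping sum settles the prime 3.

module Valuations where

  open import Data.Nat
  open import Data.Nat.Properties
  open import Data.Nat.Divisibility
  open import Data.Nat.Primality
  open import Data.Nat.Primality.Factorisation using (factorise)
  open import Data.Nat.ListAction using (product)
  open import Data.Nat.Induction using (<-wellFounded)
  open import Induction.WellFounded using (Acc; acc)
  open import Data.List using ([]; _∷_)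
  open import Data.List.Relation.Unary.All using (All; _∷_)
  open import Data.Product using (∃; ∃-syntax; _×_; _,_)
  open import Data.Sum using ([_,_]′)
  open import Function using (_∘_)
  open import Algebra.Properties.CommutativeSemigroup *-commutativeSemigroup
    using () renaming (interchange to *-interchange)
  open import Relation.Nullary using (¬_; yes; no; contradiction)
  open import Relation.Binary.PropositionalEquality

  record Valuation (p x e : ℕ) : Set where
    constructor valuation
    field
      cofactor   : ℕ
      factored   : x ≡ p ^ e * cofactor
      p∤cofactor : ¬ p ∣ cofactor

  module _ {p : ℕ} .{{_ : NonTrivial p}} where

    private instance
      p≢0 : NonZero p
      p≢0 = nonTrivial⇒nonZero p

    p∤1 : ¬ p ∣ 1
    p∤1 p∣1 = <⇒≢ (nonTrivial⇒n>1 p) (sym (∣1⇒≡1 p∣1))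

    val-one : Valuation p 1 0
    val-one = valuation 1 refl p∤1

    val-exists : ∀ x → .{{NonZero x}} → ∃ (Valuation p x)
    val-exists x = go x (<-wellFounded x)
      where
      go : ∀ x → .{{NonZero x}} → Acc _<_ x → ∃ (Valuation p x)
      go x (acc smaller) with p ∣? x
      ... | no p∤x = 0 , valuation x (sym (*-identityˡ x)) p∤x
      ... | yes p∣x@(divides q x≡q*p) with go q {{quotient≢0 p∣x}} (smaller (quotient-< p∣x))
      ...   | e , valuation c q≡ p∤c = suc e , valuation c eq p∤c
        where
        eq : x ≡ p ^ suc e * c
        eq = begin
          x             ≡⟨ x≡q*p ⟩
          q * p         ≡⟨ cong (_* p) q≡ ⟩
          p ^ e * c * p ≡⟨ *-comm (p ^ e * c) p ⟩
          p * (p ^ e * c) ≡⟨ *-assoc p (p ^ e) c ⟨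
          p ^ suc e * c ∎
          where open ≡-Reasoning

    p∣p^[1+e]*c : ∀ e c → p ∣ p ^ suc e * c
    p∣p^[1+e]*c e c = divides (p ^ e * c) (trans (*-assoc p (p ^ e) c) (*-comm p _))

    val-self : Valuation p p 1
    val-self = valuation 1 (sym (trans (*-identityʳ (p * 1)) (*-identityʳ p))) p∤1

    val-unique : ∀ {x a b} → Valuation p x a → Valuation p x b → a ≡ b
    val-unique (valuation c refl p∤c) (valuation c′ eq p∤c′) = go _ _ eq p∤c p∤c′
      where
      go : ∀ a b {c c′} → p ^ a * c ≡ p ^ b * c′ → ¬ p ∣ c → ¬ p ∣ c′ → a ≡ b
      go zero    zero    eq _ _ = refl
      go zero    (suc b) {c} {c′} eq p∤c _ =
        contradiction (subst (p ∣_) (trans (sym eq) (*-identityˡ c)) (p∣p^[1+e]*c b c′)) p∤c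
      go (suc a) zero    {c} {c′} eq _ p∤c′ =
        contradiction (subst (p ∣_) (trans eq (*-identityˡ c′)) (p∣p^[1+e]*c a c)) p∤c′
      go (suc a) (suc b) {c} {c′} eq p∤c p∤c′ = cong suc (go a b
        (*-cancelˡ-≡ _ _ p (trans (sym (*-assoc p (p ^ a) c)) (trans eq (*-assoc p (p ^ b) c′)))) p∤c p∤c′)

    n<p^n : ∀ n → n < p ^ n
    n<p^n zero    = z<s
    n<p^n (suc n) = begin
      1 + suc n        ≤⟨ +-mono-≤ (m^n>0 p n) (n<p^n n) ⟩
      p ^ n + p ^ n    ≡⟨ cong (p ^ n +_) (+-identityʳ (p ^ n)) ⟨
      2 * p ^ n        ≤⟨ *-monoˡ-≤ (p ^ n) (nonTrivial⇒n>1 p) ⟩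
      p * p ^ n        ∎
      where open ≤-Reasoning

    val-< : ∀ {x e} → Valuation p x e → e < x
    val-< (valuation zero refl p∤0) = contradiction (p ∣0) p∤0
    val-< {e = e} (valuation (suc c) refl _) = ≤-trans (n<p^n e) (m≤m*n (p ^ e) (suc c))

    val-* : Prime p → ∀ {x y a b} → Valuation p x a → Valuation p y b → Valuation p (x * y) (a + b)
    val-* p-prime {a = a} {b} (valuation c refl p∤c) (valuation c′ refl p∤c′) =
      valuation (c * c′) eq ([ p∤c , p∤c′ ]′ ∘ euclidsLemma c c′ p-prime)
      where
      eq : p ^ a * c * (p ^ b * c′) ≡ p ^ (a + b) * (c * c′)
      eq = trans (*-interchange (p ^ a) c (p ^ b) c′) (cong (_* (c * c′)) (sym (^-distribˡ-+-* p a b)))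

  ValuationsBelow : ℕ → ℕ → Set
  ValuationsBelow a b = ∀ q → Prime q → ∀ {e f} → Valuation q a e → Valuation q b f → e ≤ f

  module _ {p} (p-prime : Prime p) where

    private instance
      p-nontrivial : NonTrivial p
      p-nontrivial = prime⇒nonTrivial p-prime
      p-nonzero : NonZero p
      p-nonzero = prime⇒nonZero p-prime

    -- The prime p of p * a′ can be cancelled against a factor p of b: the
    -- hypothesis forces ν_p(b) ≥ 1, and removing p lowers both sides alike.
    peel-prime : ∀ a′ b .{{_ : NonZero a′}} .{{_ : NonZero b}} → ValuationsBelow (p * a′) b →
      ∃[ b′ ] b ≡ p * b′ × NonZero b′ × ValuationsBelow a′ b′
    peel-prime a′ b below with val-exists a′ | val-exists b
    ... | e , vₑ | zero , v₀ = contradiction (below p p-prime (val-* p-prime val-self vₑ) v₀) λ ()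
    ... | _      | suc f , valuation c refl _ = p ^ f * c , *-assoc p (p ^ f) c , b′≢0 , below′
      where
      b′≢0 : NonZero (p ^ f * c)
      b′≢0 = m*n≢0 _ _ {{m^n≢0 p f}} {{m*n≢0⇒n≢0 (p ^ suc f)}}
      -- at a prime q, the valuation δ of p is added to both sides
      below′ : ValuationsBelow a′ (p ^ f * c)
      below′ q q-prime {f = f′} vₐ v_b with val-exists {q} {{prime⇒nonTrivial q-prime}} p
      ... | δ , v_δ = +-cancelˡ-≤ δ _ _ (below q q-prime (val-* q-prime v_δ vₐ)
        (subst (λ x → Valuation q x (δ + f′)) (sym (*-assoc p (p ^ f) c)) (val-* q-prime v_δ v_b)))

  ∣-by-valuations : ∀ a b .{{_ : NonZero a}} .{{_ : NonZero b}} → ValuationsBelow a b → a ∣ b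
  ∣-by-valuations a b below with factorise a
  ... | record { factors = ps ; isFactorisation = refl ; factorsPrime = ps-prime } =
    ∏-∣ ps ps-prime b below
    where
    ∏-∣ : ∀ ps → All Prime ps → ∀ b .{{_ : NonZero b}} → ValuationsBelow (product ps) b → product ps ∣ b
    ∏-∣ []       _                    b _     = 1∣ b
    ∏-∣ (p ∷ ps) (p-prime ∷ ps-prime) b below
      with peel-prime p-prime (product ps) b {{productOfPrimes≢0 ps-prime}} below
    ... | b′ , refl , b′≢0 , below′ = *-monoʳ-∣ p (∏-∣ ps ps-prime b′ {{b′≢0}} below′)

module Legendre where

  open import Data.Nat
  open import Data.Nat.Properties
  open import Data.Nat.DivMod
  open import Data.Nat.Divisibility
  open import Data.Nat.Primality
  open import Data.Nat.ListAction using (sum; product)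
  open import Data.List using (List; []; _∷_; map)
  open import Data.List.Relation.Unary.All using (All; []; _∷_)
  open import Data.Product using (_,_)
  open import Data.Sum using (inj₁; inj₂)
  open import Function using (_∘′_)
  open import Algebra.Properties.CommutativeSemigroup +-commutativeSemigroup
    using () renaming (interchange to +-interchange)
  open import Relation.Nullary using (¬_; Dec; yes; no; contradiction)
  open import Relation.Binary.PropositionalEquality
  open Valuations

  𝟙 : ∀ {A : Set} → Dec A → ℕ
  𝟙 (yes _) = 1
  𝟙 (no _)  = 0

  𝟙-yes : ∀ {A : Set} (a? : Dec A) → A → 𝟙 a? ≡ 1
  𝟙-yes (yes _) _ = refl
  𝟙-yes (no ¬a) a = contradiction a ¬a

  𝟙-no : ∀ {A : Set} (a? : Dec A) → ¬ A → 𝟙 a? ≡ 0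
  𝟙-no (yes a) ¬a = contradiction a ¬a
  𝟙-no (no _)  _  = refl

  𝟙-cong : ∀ {A B : Set} (a? : Dec A) (b? : Dec B) → (A → B) → (B → A) → 𝟙 a? ≡ 𝟙 b?
  𝟙-cong a? (yes b) _   B→A = 𝟙-yes a? (B→A b)
  𝟙-cong a? (no ¬b) A→B _   = 𝟙-no a? (¬b ∘′ A→B)

  ∑ : ℕ → (ℕ → ℕ) → ℕ
  ∑ zero    f = 0
  ∑ (suc N) f = ∑ N f + f (suc N)

  ∑-cong : ∀ N {f g} → (∀ i → f i ≡ g i) → ∑ N f ≡ ∑ N g
  ∑-cong zero    f≡g = refl
  ∑-cong (suc N) f≡g = cong₂ _+_ (∑-cong N f≡g) (f≡g (suc N))

  ∑-0 : ∀ N → ∑ N (λ _ → 0) ≡ 0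
  ∑-0 zero    = refl
  ∑-0 (suc N) = trans (+-identityʳ _) (∑-0 N)

  ∑-+ : ∀ N f g → ∑ N (λ i → f i + g i) ≡ ∑ N f + ∑ N g
  ∑-+ zero    f g = refl
  ∑-+ (suc N) f g = trans (cong (_+ (f (suc N) + g (suc N))) (∑-+ N f g))
                          (+-interchange (∑ N f) (∑ N g) (f (suc N)) (g (suc N)))

  ∑-≤-indicator : ∀ N e → ∑ N (λ i → 𝟙 (i ≤? e)) ≡ N ⊓ e
  ∑-≤-indicator zero    e = refl
  ∑-≤-indicator (suc N) e with suc N ≤? e
  ... | yes N<e = trans (cong (_+ 1) (trans (∑-≤-indicator N e) (m≤n⇒m⊓n≡m (<⇒≤ N<e))))
                        (trans (+-comm N 1) (sym (m≤n⇒m⊓n≡m N<e)))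
  ... | no N≮e  = trans (+-identityʳ _) (trans (∑-≤-indicator N e)
                        (trans (m≥n⇒m⊓n≡n e≤N) (sym (m≥n⇒m⊓n≡n (m≤n⇒m≤1+n e≤N)))))
    where e≤N = ≤-pred (≰⇒> N≮e)

  quotient-of : ∀ {Q r} q .{{_ : NonZero Q}} → r < Q → (r + q * Q) / Q ≡ q
  quotient-of {Q} {r} q r<Q = trans (+-distrib-/-∣ʳ r (divides q refl))
                                    (cong₂ _+_ (m<n⇒m/n≡0 r<Q) (m*n/n≡m q Q))

  floor-suc : ∀ Q .{{_ : NonZero Q}} x → suc x / Q ≡ 𝟙 (Q ∣? suc x) + x / Q
  floor-suc Q x with Q ∣? suc x
  ... | yes Q∣1+x = begin
    suc x / Q                     ≡⟨ cong (λ y → suc y / Q) (m≡m%n+[m/n]*n x Q) ⟩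
    (suc (x % Q) + x / Q * Q) / Q ≡⟨ cong (λ r → (suc r + x / Q * Q) / Q) (%-pred-≡0 (n∣m⇒m%n≡0 _ Q Q∣1+x)) ⟩
    (suc (Q ∸ 1) + x / Q * Q) / Q ≡⟨ cong (λ r → (r + x / Q * Q) / Q) (suc-pred Q) ⟩
    (1 + x / Q) * Q / Q           ≡⟨ m*n/n≡m (1 + x / Q) Q ⟩
    1 + x / Q                     ∎
    where open ≡-Reasoning
  ... | no Q∤1+x = begin
    suc x / Q                     ≡⟨ cong (λ y → suc y / Q) (m≡m%n+[m/n]*n x Q) ⟩
    (suc (x % Q) + x / Q * Q) / Q ≡⟨ quotient-of (x / Q) 1+r<Q ⟩
    x / Q                         ∎
    where
    open ≡-Reasoning
    1+r<Q : suc (x % Q) < Q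
    1+r<Q with m≤n⇒m<n∨m≡n (m%n<n x Q)
    ... | inj₁ lt = lt
    ... | inj₂ 1+r≡Q = contradiction
      (divides (suc (x / Q)) (trans (cong suc (m≡m%n+[m/n]*n x Q)) (cong (_+ x / Q * Q) 1+r≡Q))) Q∤1+x

  module _ {p} (p-prime : Prime p) where

    private instance
      p-nontrivial : NonTrivial p
      p-nontrivial = prime⇒nonTrivial p-prime

    p^i≢0 : ∀ i → NonZero (p ^ i)
    p^i≢0 i = m^n≢0 p i {{prime⇒nonZero p-prime}}

    _/p^_ : ℕ → ℕ → ℕ
    x /p^ i = (x / p ^ i) {{p^i≢0 i}}

    p^i∣p^j : ∀ {i j} → i ≤ j → p ^ i ∣ p ^ j
    p^i∣p^j {i} {j} i≤j = divides (p ^ (j ∸ i)) (begin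
      p ^ j             ≡⟨ cong (p ^_) (m+[n∸m]≡n i≤j) ⟨
      p ^ (i + (j ∸ i)) ≡⟨ ^-distribˡ-+-* p i (j ∸ i) ⟩
      p ^ i * p ^ (j ∸ i) ≡⟨ *-comm (p ^ i) _ ⟩
      p ^ (j ∸ i) * p ^ i ∎)
      where open ≡-Reasoning

    p^i∣⇒i≤val : ∀ {y e i} → Valuation p y e → p ^ i ∣ y → i ≤ e
    p^i∣⇒i≤val {e = e} {i} (valuation c refl p∤c) p^i∣y with i ≤? e
    ... | yes i≤e = i≤e
    ... | no  i≰e = contradiction (*-cancelˡ-∣ (p ^ e) p^e*p∣p^e*c) p∤c
      where
      instance _ = p^i≢0 e
      p^e*p∣p^e*c : p ^ e * p ∣ p ^ e * c
      p^e*p∣p^e*c = ∣-trans (∣-reflexive (*-comm (p ^ e) p)) (∣-trans (p^i∣p^j (≰⇒> i≰e)) p^i∣y)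

    i≤val⇒p^i∣ : ∀ {y e i} → Valuation p y e → i ≤ e → p ^ i ∣ y
    i≤val⇒p^i∣ {e = e} (valuation c refl _) i≤e = ∣-trans (p^i∣p^j i≤e) (m∣m*n c)

    legendre-sum : ℕ → ℕ → ℕ
    legendre-sum N x = ∑ N (x /p^_)

    legendre : ∀ N x → x ≤ N → Valuation p (x !) (legendre-sum N x)
    legendre N zero    _   = subst (Valuation p 1)
      (sym (trans (∑-cong N (λ i → 0/n≡0 (p ^ i) {{p^i≢0 i}})) (∑-0 N))) val-one
    legendre N (suc x) x<N with val-exists (suc x)
    ... | e , vₑ = subst (Valuation p (suc x !)) (sym raise) (val-* p-prime vₑ (legendre N x (<⇒≤ x<N)))
      where
      open ≡-Reasoning
      raise : legendre-sum N (suc x) ≡ e + legendre-sum N x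
      raise = begin
        ∑ N (suc x /p^_)                                    ≡⟨ ∑-cong N (λ i → floor-suc (p ^ i) {{p^i≢0 i}} x) ⟩
        ∑ N (λ i → 𝟙 (p ^ i ∣? suc x) + x /p^ i)           ≡⟨ ∑-+ N _ _ ⟩
        ∑ N (λ i → 𝟙 (p ^ i ∣? suc x)) + legendre-sum N x   ≡⟨ cong (_+ legendre-sum N x) (∑-cong N λ i →
                                                                 𝟙-cong _ (i ≤? e) (p^i∣⇒i≤val vₑ) (i≤val⇒p^i∣ vₑ)) ⟩
        ∑ N (λ i → 𝟙 (i ≤? e)) + legendre-sum N x           ≡⟨ cong (_+ legendre-sum N x) (∑-≤-indicator N e) ⟩
        N ⊓ e + legendre-sum N x                            ≡⟨ cong (_+ legendre-sum N x) (m≥n⇒m⊓n≡n (<⇒≤ (≤-trans (val-< vₑ) x<N))) ⟩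
        e + legendre-sum N x                                ∎

  ∏! : List ℕ → ℕ
  ∏! xs = product (map _! xs)

  ∏!≢0 : ∀ xs → NonZero (∏! xs)
  ∏!≢0 []       = _
  ∏!≢0 (x ∷ xs) = m*n≢0 (x !) (∏! xs) {{x !≢0}} {{∏!≢0 xs}}

  module _ {p} (p-prime : Prime p) where

    private instance
      p-nontrivial : NonTrivial p
      p-nontrivial = prime⇒nonTrivial p-prime

    -- ∑_{x ∈ xs} ⌊x / p^i⌋: the contribution of the prime power p^i to the valuation of ∏ xs!.
    level-sum : ℕ → List ℕ → ℕ
    level-sum i xs = sum (map (λ x → _/p^_ p-prime x i) xs)

    legendre-∏ : ∀ N xs → All (_≤ N) xs → Valuation p (∏! xs) (∑ N (λ i → level-sum i xs))
    legendre-∏ N []       []           = subst (Valuation p 1) (sym (∑-0 N)) val-one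
    legendre-∏ N (x ∷ xs) (x≤N ∷ xs≤N) = subst (Valuation p (x ! * ∏! xs)) (sym (∑-+ N _ _))
      (val-* p-prime (legendre p-prime N x x≤N) (legendre-∏ N xs xs≤N))

  landau : ∀ N xs ys → All (_≤ N) xs → All (_≤ N) ys →
    (∀ p (p-prime : Prime p) → ∑ N (λ i → level-sum p-prime i ys) ≤ ∑ N (λ i → level-sum p-prime i xs)) →
    ∏! ys ∣ ∏! xs
  landau N xs ys xs≤N ys≤N dominated = ∣-by-valuations (∏! ys) (∏! xs) {{∏!≢0 ys}} {{∏!≢0 xs}}
    λ p p-prime v-ys v-xs → let instance _ = prime⇒nonTrivial p-prime in
      subst₂ _≤_ (val-unique (legendre-∏ p-prime N ys ys≤N) v-ys) (val-unique (legendre-∏ p-prime N xs xs≤N) v-xs)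
        (dominated p p-prime)

module ResidueGain where

  open import Data.Nat
  open import Data.Nat.Properties
  open import Data.Nat.DivMod
  open import Data.Nat.Divisibility
  open import Data.Nat.Tactic.RingSolver using (solve-∀)
  open import Relation.Nullary using (Dec; ¬?; _→-dec_)
  open import Relation.Nullary.Decidable using (True; toWitness)
  open import Relation.Binary.PropositionalEquality

  -- In terms of K = ⌊6k/Q⌋, M = ⌊6m/Q⌋ and W = ⌊6n/Q⌋ the floor sums of the
  -- numerator (6k)!(6m)!(2n)! and the denominator (3k)!(3m)!(3n)!(2k)!(2m)! are:
  top : ℕ → ℕ → ℕ → ℕ
  top K M W = K + M + W / 3

  bot : ℕ → ℕ → ℕ → ℕ
  bot K M W = K / 2 + M / 2 + W / 2 + K / 3 + M / 3

  -- Their difference, for W = K + M + d, depends only on K mod 6, M mod 6 and d.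
  gain : ℕ → ℕ → ℕ → ℕ
  gain r s d = top r s (r + s + d) ∸ bot r s (r + s + d)

  by-table : ∀ {P : ℕ → ℕ → ℕ → Set} (P? : ∀ r s d → Dec (P r s d)) →
    True (allUpTo? (λ r → allUpTo? (λ s → allUpTo? (P? r s) 2) 6) 6) →
    ∀ {r s d} → r < 6 → s < 6 → d < 2 → P r s d
  by-table P? table r<6 s<6 d<2 = toWitness table r<6 s<6 d<2

  /-shift : ∀ q .{{_ : NonZero q}} x a c → (x + a * (c * q)) / q ≡ x / q + a * c
  /-shift q x a c = trans (+-distrib-/-∣ʳ x (divides (a * c) (sym (*-assoc a c q))))
                          (cong (x / q +_) (trans (cong (_/ q) (sym (*-assoc a c q))) (m*n/n≡m (a * c) q)))

  top-shift : ∀ r s w a b → top (r + a * 6) (s + b * 6) (w + (a + b) * 6) ≡ top r s w + (a + b) * 8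
  top-shift r s w a b rewrite /-shift 3 w (a + b) 2 = lemma r s (w / 3) a b
    where
    lemma : ∀ r s w′ a b → r + a * 6 + (s + b * 6) + (w′ + (a + b) * 2) ≡ r + s + w′ + (a + b) * 8
    lemma = solve-∀

  bot-shift : ∀ r s w a b → bot (r + a * 6) (s + b * 6) (w + (a + b) * 6) ≡ bot r s w + (a + b) * 8
  bot-shift r s w a b
    rewrite /-shift 2 r a 3 | /-shift 2 s b 3 | /-shift 2 w (a + b) 3 | /-shift 3 r a 2 | /-shift 3 s b 2
    = lemma (r / 2) (s / 2) (w / 2) (r / 3) (s / 3) a b
    where
    lemma : ∀ r₂ s₂ w₂ r₃ s₃ a b →
      r₂ + a * 3 + (s₂ + b * 3) + (w₂ + (a + b) * 3) + (r₃ + a * 2) + (s₃ + b * 2) ≡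
      r₂ + s₂ + w₂ + r₃ + s₃ + (a + b) * 8
    lemma = solve-∀

  bot≤top-residues : ∀ {r s d} → r < 6 → s < 6 → d < 2 → bot r s (r + s + d) ≤ top r s (r + s + d)
  bot≤top-residues = by-table (λ r s d → bot r s (r + s + d) ≤? top r s (r + s + d)) _

  top≡bot+gain : ∀ K M d → d < 2 →
    top K M (K + M + d) ≡ bot K M (K + M + d) + gain (K % 6) (M % 6) d
  top≡bot+gain K M d d<2 =
    subst₂ (λ K′ M′ → top K′ M′ (K′ + M′ + d) ≡ bot K′ M′ (K′ + M′ + d) + gain (K % 6) (M % 6) d)
      (sym (m≡m%n+[m/n]*n K 6)) (sym (m≡m%n+[m/n]*n M 6))
      (periodic (K % 6) (M % 6) (K / 6) (M / 6) (m%n<n K 6) (m%n<n M 6))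
    where
    regroup : ∀ r s d a b → r + a * 6 + (s + b * 6) + d ≡ r + s + d + (a + b) * 6
    regroup = solve-∀
    periodic : ∀ r s a b → r < 6 → s < 6 →
      top (r + a * 6) (s + b * 6) (r + a * 6 + (s + b * 6) + d) ≡
      bot (r + a * 6) (s + b * 6) (r + a * 6 + (s + b * 6) + d) + gain r s d
    periodic r s a b r<6 s<6 rewrite regroup r s d a b | top-shift r s (r + s + d) a b | bot-shift r s (r + s + d) a b =
      begin
        top r s w + (a + b) * 8                ≡⟨ cong (_+ (a + b) * 8) (m+[n∸m]≡n (bot≤top-residues r<6 s<6 d<2)) ⟨
        bot r s w + gain r s d + (a + b) * 8   ≡⟨ +-assoc (bot r s w) _ _ ⟩
        bot r s w + (gain r s d + (a + b) * 8) ≡⟨ cong (bot r s w +_) (+-comm (gain r s d) _) ⟩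
        bot r s w + ((a + b) * 8 + gain r s d) ≡⟨ +-assoc (bot r s w) _ _ ⟨
        bot r s w + (a + b) * 8 + gain r s d   ∎
      where
      open ≡-Reasoning
      w = r + s + d

  gain-odd-multiple-of-3 : ∀ {r s d} → r < 6 → s < 6 → d < 2 → (r + s + d) % 6 ≡ 3 → 1 ≤ gain r s d
  gain-odd-multiple-of-3 = by-table (λ r s d → (r + s + d) % 6 ≟ 3 →-dec 1 ≤? gain r s d) _

  gain-nonzero-evens : ∀ {r s} → r < 6 → s < 6 → r % 2 ≡ 0 → s % 2 ≡ 0 → r ≢ 0 → s ≢ 0 →
    (r + s) % 6 ≡ 4 → 1 ≤ gain r s 0
  gain-nonzero-evens r<6 s<6 r-even s-even r≢0 s≢0 = by-table
    (λ r s _ → r % 2 ≟ 0 →-dec s % 2 ≟ 0 →-dec ¬? (r ≟ 0) →-dec ¬? (s ≟ 0) →-dec (r + s) % 6 ≟ 4 →-dec 1 ≤? gain r s 0)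
    _ r<6 s<6 (s≤s z≤n) r-even s-even r≢0 s≢0

  gain-even-odd : ∀ {r s} → r < 6 → s < 6 → r % 2 ≡ 0 → (r + s) % 2 ≡ 1 → 1 ≤ gain r s 0
  gain-even-odd r<6 s<6 = by-table
    (λ r s _ → r % 2 ≟ 0 →-dec (r + s) % 2 ≟ 1 →-dec 1 ≤? gain r s 0) _ r<6 s<6 (s≤s z≤n)

  gain-even-three : ∀ {r s} → r < 6 → s < 6 → r % 2 ≡ 0 → r ≢ 0 → (r + s) % 6 ≡ 3 → 2 ≤ gain r s 0
  gain-even-three r<6 s<6 = by-table
    (λ r s _ → r % 2 ≟ 0 →-dec ¬? (r ≟ 0) →-dec (r + s) % 6 ≟ 3 →-dec 2 ≤? gain r s 0) _ r<6 s<6 (s≤s z≤n)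

module SingleLevel where

  open import Data.Nat
  open import Data.Nat.Properties
  open import Data.Nat.DivMod
  open import Data.Nat.Divisibility
  open import Data.Nat.Tactic.RingSolver using (solve-∀)
  open import Data.Product using (∃-syntax; _,_; proj₁; proj₂)
  open import Data.Sum using (_⊎_; inj₁; inj₂; [_,_]′)
  open import Function using (_∘_)
  open import Relation.Nullary using (¬_; yes; no; contradiction; _×-dec_)
  open import Relation.Nullary.Decidable using (toSum)
  open import Relation.Binary.PropositionalEquality
  open Legendre using (quotient-of; 𝟙; 𝟙-yes; 𝟙-no)
  open ResidueGain

  /-scale : ∀ Q .{{_ : NonZero Q}} d .{{_ : NonZero d}} c x → (c * x) / Q ≡ (c * d * x / Q) / d
  /-scale Q d c x = begin
    c * x / Q             ≡⟨ m*n/o*n≡m/o (c * x) d Q ⟨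
    c * x * d / (Q * d)   ≡⟨ cong (λ y → y / (Q * d)) (lemma c x d) ⟩
    c * d * x / (Q * d)   ≡⟨ m/n/o≡m/[n*o] (c * d * x) Q d ⟨
    c * d * x / Q / d     ∎
    where
    open ≡-Reasoning
    instance _ = m*n≢0 Q d
    lemma : ∀ c x d → c * x * d ≡ c * d * x
    lemma = solve-∀

  F : (Q : ℕ) .{{_ : NonZero Q}} → ℕ → ℕ → ℕ → ℕ
  F Q k m n = 6 * k / Q + 6 * m / Q + 2 * n / Q

  D : (Q : ℕ) .{{_ : NonZero Q}} → ℕ → ℕ → ℕ → ℕ
  D Q k m n = 3 * k / Q + 3 * m / Q + 3 * n / Q + 2 * k / Q + 2 * m / Q

  F-sym : ∀ Q .{{_ : NonZero Q}} k m n → F Q m k n ≡ F Q k m n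
  F-sym Q k m n = cong (_+ 2 * n / Q) (+-comm (6 * m / Q) (6 * k / Q))

  D-sym : ∀ Q .{{_ : NonZero Q}} k m n → D Q m k n ≡ D Q k m n
  D-sym Q k m n = swap (3 * m / Q) (3 * k / Q) (3 * n / Q) (2 * m / Q) (2 * k / Q)
    where
    swap : ∀ a b c d e → a + b + c + d + e ≡ b + a + c + e + d
    swap = solve-∀

  2a≢1+2b : ∀ a b → 2 * a ≢ suc (2 * b)
  2a≢1+2b a b eq = 0≢1+n (begin
    0                 ≡⟨ m*n%n≡0 a 2 ⟨
    a * 2 % 2         ≡⟨ cong (_% 2) (trans (*-comm a 2) eq) ⟩
    suc (2 * b) % 2   ≡⟨ cong (λ x → suc x % 2) (*-comm 2 b) ⟩
    (1 + b * 2) % 2   ≡⟨ [m+kn]%n≡m%n 1 b 2 ⟩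
    1                 ∎)
    where open ≡-Reasoning

  2c%6-even : ∀ c → 2 * c % 6 % 2 ≡ 0
  2c%6-even c = trans (m∣n⇒o%n%m≡o%m 2 6 (2 * c) (divides 3 refl))
                      (trans (cong (_% 2) (*-comm 2 c)) (m*n%n≡0 c 2))

  2c%6≢0 : ∀ {c} → ¬ 3 ∣ c → 2 * c % 6 ≢ 0
  2c%6≢0 {c} 3∤c 2c%6≡0 = 3∤c (*-cancelˡ-∣ 2 (m%n≡0⇒n∣m (2 * c) 6 2c%6≡0))

  shared : ℕ → ℕ → ℕ → ℕ
  shared Y x X = 𝟙 (X ∣? x ×-dec X ∣? Y)

  shared-yes : ∀ {Y x X} → X ∣ x → X ∣ Y → shared Y x X ≡ 1
  shared-yes {Y} {x} {X} X∣x X∣Y = 𝟙-yes (X ∣? x ×-dec X ∣? Y) (X∣x , X∣Y)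

  shared-no : ∀ {Y x X} → ¬ X ∣ x → shared Y x X ≡ 0
  shared-no {Y} {x} {X} X∤x = 𝟙-no (X ∣? x ×-dec X ∣? Y) (X∤x ∘ proj₁)

  shared-∤Y : ∀ {Y x X} → ¬ X ∣ Y → shared Y x X ≡ 0
  shared-∤Y {Y} {x} {X} X∤Y = 𝟙-no (X ∣? x ×-dec X ∣? Y) (X∤Y ∘ proj₂)

  module LevelAnalysis (k m n Y : ℕ) (k+m≡n : k + m ≡ n) (2n≡1+Y : 2 * n ≡ suc Y) where

    module _ (Q : ℕ) .{{_ : NonZero Q}} where

      K M W carry : ℕ
      K = 6 * k / Q
      M = 6 * m / Q
      W = 6 * n / Q
      carry = (6 * k % Q + 6 * m % Q) / Q

      G : ℕ
      G = gain (K % 6) (M % 6) carry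

      carry<2 : carry < 2
      carry<2 = m<n*o⇒m/o<n (+-mono-< (m%n<n (6 * k) Q) (subst (6 * m % Q <_) (sym (+-identityʳ Q)) (m%n<n (6 * m) Q)))

      W≡K+M+carry : W ≡ K + M + carry
      W≡K+M+carry = begin
        6 * n / Q                                          ≡⟨ cong (λ x → 6 * x / Q) k+m≡n ⟨
        6 * (k + m) / Q                                    ≡⟨ cong (_/ Q) split ⟩
        (6 * k % Q + 6 * m % Q + (K + M) * Q) / Q          ≡⟨ quotient-of′ ⟩
        K + M + carry                                      ∎
        where
        open ≡-Reasoning
        split : 6 * (k + m) ≡ 6 * k % Q + 6 * m % Q + (K + M) * Q
        split = begin
          6 * (k + m)                                    ≡⟨ *-distribˡ-+ 6 k m ⟩
          6 * k + 6 * m                                  ≡⟨ cong₂ _+_ (m≡m%n+[m/n]*n (6 * k) Q) (m≡m%n+[m/n]*n (6 * m) Q) ⟩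
          (6 * k % Q + K * Q) + (6 * m % Q + M * Q)      ≡⟨ regroup (6 * k % Q) K (6 * m % Q) M Q ⟩
          6 * k % Q + 6 * m % Q + (K + M) * Q            ∎
          where
          regroup : ∀ a K b M Q → (a + K * Q) + (b + M * Q) ≡ a + b + (K + M) * Q
          regroup = solve-∀
        quotient-of′ : (6 * k % Q + 6 * m % Q + (K + M) * Q) / Q ≡ K + M + carry
        quotient-of′ = trans (+-distrib-/-∣ʳ _ (divides (K + M) refl))
                             (trans (cong (carry +_) (m*n/n≡m (K + M) Q)) (+-comm carry (K + M)))

      F≡top : F Q k m n ≡ top K M W
      F≡top = cong (K + M +_) (/-scale Q 3 2 n)

      D≡bot : D Q k m n ≡ bot K M W
      D≡bot = cong₂ _+_ (cong₂ _+_ (cong₂ _+_ (cong₂ _+_ (/-scale Q 2 3 k) (/-scale Q 2 3 m)) (/-scale Q 2 3 n))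
                                   (/-scale Q 3 2 k)) (/-scale Q 3 2 m)

      F≡D+gain : F Q k m n ≡ D Q k m n + G
      F≡D+gain = begin
        F Q k m n                                          ≡⟨ F≡top ⟩
        top K M W                                          ≡⟨ cong (top K M) W≡K+M+carry ⟩
        top K M (K + M + carry)                            ≡⟨ top≡bot+gain K M carry carry<2 ⟩
        bot K M (K + M + carry) + G ≡⟨ cong (λ w → bot K M w + G) W≡K+M+carry ⟨
        bot K M W + G             ≡⟨ cong (_+ G) D≡bot ⟨
        D Q k m n + G             ∎
        where open ≡-Reasoning

      excess : ∀ g → g ≤ G → g + D Q k m n ≤ F Q k m n
      excess g g≤G = subst (g + D Q k m n ≤_) (sym F≡D+gain)
        (≤-trans (≤-reflexive (+-comm g _)) (+-monoʳ-≤ (D Q k m n) g≤G))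

      D≤F : D Q k m n ≤ F Q k m n
      D≤F = excess 0 z≤n

      residues : (K % 6 + M % 6 + carry) % 6 ≡ W % 6
      residues = begin
        (K % 6 + M % 6 + carry) % 6            ≡⟨ %-distribˡ-+ (K % 6 + M % 6) carry 6 ⟩
        ((K % 6 + M % 6) % 6 + carry % 6) % 6  ≡⟨ cong (λ x → (x + carry % 6) % 6) (%-distribˡ-+ K M 6) ⟨
        ((K + M) % 6 + carry % 6) % 6          ≡⟨ %-distribˡ-+ (K + M) carry 6 ⟨
        (K + M + carry) % 6                    ≡⟨ cong (_% 6) W≡K+M+carry ⟨
        W % 6                                  ∎
        where open ≡-Reasoning

      carry-zero : Q ∣ 6 * k → carry ≡ 0
      carry-zero Q∣6k = trans (cong (λ r → (r + 6 * m % Q) / Q) (n∣m⇒m%n≡0 (6 * k) Q Q∣6k))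
                              (m<n⇒m/n≡0 (m%n<n (6 * m) Q))

      excess₀ : Q ∣ 6 * k → ∀ g → g ≤ gain (K % 6) (M % 6) 0 → g + D Q k m n ≤ F Q k m n
      excess₀ Q∣6k g g≤ = excess g (subst (λ c → g ≤ gain (K % 6) (M % 6) c) (sym (carry-zero Q∣6k)) g≤)

      residues₀ : Q ∣ 6 * k → (K % 6 + M % 6) % 6 ≡ W % 6
      residues₀ Q∣6k = trans (cong (_% 6) (sym (trans (cong (K % 6 + M % 6 +_) (carry-zero Q∣6k)) (+-identityʳ _))))
                             residues

      W-from : ∀ w → 6 * n ≡ 3 + w * Q → 3 < Q → W ≡ w
      W-from w 6n≡ 3<Q = trans (cong (_/ Q) 6n≡) (quotient-of w 3<Q)

    6n≡3+3Y : 6 * n ≡ 3 + 3 * Y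
    6n≡3+3Y = trans (*-assoc 3 2 n) (trans (cong (3 *_) 2n≡1+Y) (*-suc 3 Y))

    2∤Y : ¬ 2 ∣ Y
    2∤Y (divides t Y≡t*2) = 2a≢1+2b n t (trans 2n≡1+Y (cong suc (trans Y≡t*2 (*-comm t 2))))

    Y≢0 : NonZero Y
    Y≢0 = ≢-nonZero λ Y≡0 → 2∤Y (subst (2 ∣_) (sym Y≡0) (2 ∣0))

    odd-cofactor : ∀ {t X} → Y ≡ t * X → ∃[ j ] t ≡ suc (j * 2)
    odd-cofactor {t} {X} Y≡tX with t % 2 | m%n<n t 2 | m≡m%n+[m/n]*n t 2
    ... | 1           | _            | t≡1+j*2 = t / 2 , t≡1+j*2
    ... | suc (suc _) | s≤s (s≤s ()) | _
    ... | 0           | _            | t≡j*2   =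
      contradiction (divides (t / 2 * X) (trans Y≡tX (trans (cong (_* X) t≡j*2) (regroup (t / 2) X)))) 2∤Y
      where
      regroup : ∀ j X → j * 2 * X ≡ j * X * 2
      regroup = solve-∀

    -- No R ≥ 2 divides k, m and Y, because it would divide 2n = Y + 1.
    not-both : ∀ {R} → 2 ≤ R → R ∣ k → R ∣ m → ¬ R ∣ Y
    not-both {R} 2≤R R∣k R∣m R∣Y = <⇒≢ 2≤R (sym (∣1⇒≡1 (∣m+n∣m⇒∣n R∣Y+1 R∣Y)))
      where
      R∣Y+1 : R ∣ Y + 1
      R∣Y+1 = subst (R ∣_) (trans 2n≡1+Y (+-comm 1 Y))
                (subst (λ x → R ∣ 2 * x) k+m≡n (∣n⇒∣m*n 2 (∣m∣n⇒∣m+n R∣k R∣m)))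

    -- For a modulus Q ≥ 4 dividing Y = tQ: 6n = 3 + 3tQ, so W = 3t ≡ 3 (mod 6) as t is odd.
    W≡3-mod-6 : ∀ Q .{{_ : NonZero Q}} → 4 ≤ Q → Q ∣ Y → W Q % 6 ≡ 3
    W≡3-mod-6 Q 4≤Q (divides t Y≡tQ) with odd-cofactor {t} {Q} Y≡tQ
    ... | j , refl = begin
      W Q % 6                 ≡⟨ cong (_% 6) (W-from Q (3 * suc (j * 2)) 6n≡ 4≤Q) ⟩
      3 * suc (j * 2) % 6     ≡⟨ cong (_% 6) (lemma j) ⟩
      (3 + j * 6) % 6         ≡⟨ [m+kn]%n≡m%n 3 j 6 ⟩
      3                       ∎
      where
      open ≡-Reasoning
      6n≡ : 6 * n ≡ 3 + 3 * suc (j * 2) * Q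
      6n≡ = trans 6n≡3+3Y (trans (cong (λ y → 3 + 3 * y) Y≡tQ) (cong (3 +_) (sym (*-assoc 3 (suc (j * 2)) Q))))
      lemma : ∀ j → 3 * suc (j * 2) ≡ 3 + j * 6
      lemma = solve-∀

    excess-large : ∀ Q .{{_ : NonZero Q}} → 4 ≤ Q → Q ∣ Y → 1 + D Q k m n ≤ F Q k m n
    excess-large Q 4≤Q Q∣Y = excess Q 1 (gain-odd-multiple-of-3 (m%n<n (K Q) 6) (m%n<n (M Q) 6) (carry<2 Q)
      (trans (residues Q) (W≡3-mod-6 Q 4≤Q Q∣Y)))

    -- Level 3 dividing Y, with 3 ∤ k and 3 ∤ m: here K = 2k, M = 2m and W = 2n ≡ 4 (mod 6).
    excess-three : ¬ 3 ∣ k → ¬ 3 ∣ m → 3 ∣ Y → 1 + D 3 k m n ≤ F 3 k m n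
    excess-three 3∤k 3∤m (divides t Y≡t*3) with odd-cofactor {t} {3} Y≡t*3
    ... | j , refl = excess₀ 3 3∣6k 1 (subst₂ (λ K M → 1 ≤ gain (K % 6) (M % 6) 0) (sym (6x/3≡2x k)) (sym (6x/3≡2x m))
      (gain-nonzero-evens (m%n<n (2 * k) 6) (m%n<n (2 * m) 6) (2c%6-even k) (2c%6-even m) (2c%6≢0 3∤k) (2c%6≢0 3∤m)
        (subst₂ (λ K M → (K % 6 + M % 6) % 6 ≡ 4) (6x/3≡2x k) (6x/3≡2x m) (trans (residues₀ 3 3∣6k) W%6≡4))))
      where
      open ≡-Reasoning
      6x≡2x*3 : ∀ x → 6 * x ≡ 2 * x * 3
      6x≡2x*3 = solve-∀
      6x/3≡2x : ∀ x → 6 * x / 3 ≡ 2 * x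
      6x/3≡2x x = trans (cong (_/ 3) (6x≡2x*3 x)) (m*n/n≡m (2 * x) 3)
      3∣6k : 3 ∣ 6 * k
      3∣6k = divides (2 * k) (6x≡2x*3 k)
      W%6≡4 : W 3 % 6 ≡ 4
      W%6≡4 = begin
        6 * n / 3 % 6                ≡⟨ cong (_% 6) (6x/3≡2x n) ⟩
        2 * n % 6                    ≡⟨ cong (_% 6) (trans 2n≡1+Y (cong suc Y≡t*3)) ⟩
        suc (suc (j * 2) * 3) % 6    ≡⟨ cong (_% 6) (lemma j) ⟩
        (4 + j * 6) % 6              ≡⟨ [m+kn]%n≡m%n 4 j 6 ⟩
        4                            ∎
        where
        lemma : ∀ j → suc (suc (j * 2) * 3) ≡ 4 + j * 6
        lemma = solve-∀

    -- The inequality at level Q, receiving credit c from the level below and passing on credit c′.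
    Claim : (Q : ℕ) .{{_ : NonZero Q}} → ℕ → ℕ → Set
    Claim Q c c′ = D Q k m n + 𝟙 (Q ∣? Y) + c ≤ F Q k m n + c′

    claim-by : ∀ Q .{{_ : NonZero Q}} {c′} → (Q ∣ Y → 1 + D Q k m n ≤ F Q k m n ⊎ 1 ≤ c′) → Claim Q 0 c′
    claim-by Q {c′} pay with Q ∣? Y
    ... | no  _   = subst (_≤ F Q k m n + c′) (sym (trans (+-identityʳ _) (+-identityʳ _)))
                      (≤-trans (D≤F Q) (m≤m+n _ c′))
    ... | yes Q∣Y = [ (λ 1+D≤F → subst (_≤ F Q k m n + c′) (regroup (D Q k m n)) (≤-trans 1+D≤F (m≤m+n _ c′)))
                    , (λ 1≤c′ → subst (_≤ F Q k m n + c′) (sym (+-identityʳ _)) (+-mono-≤ (D≤F Q) 1≤c′))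
                    ]′ (pay Q∣Y)
      where
      regroup : ∀ d → 1 + d ≡ d + 1 + 0
      regroup = solve-∀

    -- Level Q = 3R where R ≥ 3 divides k = cR: then 6k = 2c·Q, so K = 2c and there is no carry.
    module _ (R : ℕ) .{{_ : NonZero R}} (3≤R : 3 ≤ R) (R∣k : R ∣ k) where

      private instance
        3R≢0 : NonZero (3 * R)
        3R≢0 = m*n≢0 3 R

      private
        regroup₁ : ∀ d → 1 + (1 + d) ≡ d + 1 + 1
        regroup₁ = solve-∀
        regroup₂ : ∀ d → 2 + d ≡ d + 1 + 1
        regroup₂ = solve-∀
        regroup₃ : ∀ d → 1 + d ≡ d + 0 + 1
        regroup₃ = solve-∀

        c = quotient R∣k

        6k≡2c*3R : 6 * k ≡ 2 * c * (3 * R)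
        6k≡2c*3R = trans (cong (6 *_) (_∣_.equality R∣k)) (lemma c R)
          where
          lemma : ∀ c R → 6 * (c * R) ≡ 2 * c * (3 * R)
          lemma = solve-∀

        3R∣6k : 3 * R ∣ 6 * k
        3R∣6k = divides (2 * c) 6k≡2c*3R

        K≡2c : K (3 * R) ≡ 2 * c
        K≡2c = trans (cong (_/ (3 * R)) 6k≡2c*3R) (m*n/n≡m (2 * c) (3 * R))

        K-even : K (3 * R) % 6 % 2 ≡ 0
        K-even = subst (λ x → x % 6 % 2 ≡ 0) (sym K≡2c) (2c%6-even c)

        4≤3R : 4 ≤ 3 * R
        4≤3R = ≤-trans (s≤s (s≤s (s≤s (s≤s z≤n)))) (*-monoʳ-≤ 3 3≤R)

      -- If also R ∣ Y = tR, then W = t is odd while K is even.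
      excess-R∣k,Y : R ∣ Y → 1 + D (3 * R) k m n ≤ F (3 * R) k m n
      excess-R∣k,Y (divides t Y≡tR) with odd-cofactor {t} {R} Y≡tR
      ... | j , refl = excess₀ (3 * R) 3R∣6k 1 (gain-even-odd (m%n<n (K Q) 6) (m%n<n (M Q) 6) K-even sum-odd)
        where
        open ≡-Reasoning
        Q = 3 * R
        6n≡ : 6 * n ≡ 3 + suc (j * 2) * Q
        6n≡ = trans 6n≡3+3Y (cong (3 +_) (trans (cong (3 *_) Y≡tR) (lemma (suc (j * 2)) R)))
          where
          lemma : ∀ t R → 3 * (t * R) ≡ t * (3 * R)
          lemma = solve-∀
        sum-odd : (K Q % 6 + M Q % 6) % 2 ≡ 1
        sum-odd = begin
          (K Q % 6 + M Q % 6) % 2          ≡⟨ m∣n⇒o%n%m≡o%m 2 6 (K Q % 6 + M Q % 6) (divides 3 refl) ⟨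
          (K Q % 6 + M Q % 6) % 6 % 2      ≡⟨ cong (_% 2) (residues₀ Q 3R∣6k) ⟩
          W Q % 6 % 2                      ≡⟨ m∣n⇒o%n%m≡o%m 2 6 (W Q) (divides 3 refl) ⟩
          W Q % 2                          ≡⟨ cong (_% 2) (W-from Q (suc (j * 2)) 6n≡ 4≤3R) ⟩
          suc (j * 2) % 2                  ≡⟨ [m+kn]%n≡m%n 1 j 2 ⟩
          1                                ∎

      -- If moreover 3R ∣ Y but 3R ∤ k, then W ≡ 3 (mod 6) while K ≢ 0 (mod 6): the excess is 2.
      excess-R∣k,3R∣Y : 3 * R ∣ Y → ¬ 3 * R ∣ k → 2 + D (3 * R) k m n ≤ F (3 * R) k m n
      excess-R∣k,3R∣Y 3R∣Y 3R∤k = excess₀ (3 * R) 3R∣6k 2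
        (gain-even-three (m%n<n (K (3 * R)) 6) (m%n<n (M (3 * R)) 6) K-even K≢0
          (trans (residues₀ (3 * R) 3R∣6k) (W≡3-mod-6 (3 * R) 4≤3R 3R∣Y)))
        where
        3∤c : ¬ 3 ∣ c
        3∤c (divides v c≡v*3) =
          3R∤k (divides v (trans (_∣_.equality R∣k) (trans (cong (_* R) c≡v*3) (*-assoc v 3 R))))
        K≢0 : K (3 * R) % 6 ≢ 0
        K≢0 = subst (λ x → x % 6 ≢ 0) (sym K≡2c) (2c%6≢0 3∤c)

      -- With R ∣ k and R ∣ Y the level 3R absorbs one unit of incoming credit,
      -- passing one on only if 3R still divides both k and Y.
      claim-R∣k,Y : R ∣ Y → D (3 * R) k m n + 𝟙 (3 * R ∣? Y) + 1 ≤ F (3 * R) k m n + shared Y k (3 * R)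
      claim-R∣k,Y R∣Y with 3 * R ∣? Y | toSum (3 * R ∣? k)
      ... | yes 3R∣Y | inj₁ 3R∣k = subst₂ _≤_ (regroup₁ _)
          (trans (+-comm 1 _) (cong (F (3 * R) k m n +_) (sym (𝟙-yes (3 * R ∣? k ×-dec yes 3R∣Y) (3R∣k , 3R∣Y)))))
          (+-monoʳ-≤ 1 (excess-R∣k,Y R∣Y))
      ... | yes 3R∣Y | inj₂ 3R∤k = subst₂ _≤_ (regroup₂ _)
          (sym (trans (cong (F (3 * R) k m n +_) (𝟙-no (3 * R ∣? k ×-dec yes 3R∣Y) (3R∤k ∘ proj₁))) (+-identityʳ _)))
          (excess-R∣k,3R∣Y 3R∣Y 3R∤k)
      ... | no 3R∤Y  | _         = subst (_≤ F (3 * R) k m n + 𝟙 (3 * R ∣? k ×-dec no 3R∤Y)) (regroup₃ (D (3 * R) k m n))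
          (≤-trans (excess-R∣k,Y R∣Y) (m≤m+n _ _))

module PrimeBounds where

  open import Data.Nat
  open import Data.Nat.Properties
  open import Data.Nat.Divisibility
  open import Data.Nat.Primality
  open import Data.Nat.Tactic.RingSolver using (solve-∀)
  open import Data.Sum using (inj₁; inj₂)
  open import Function using (_∘_)
  open import Relation.Nullary using (¬_; yes; no; contradiction)
  open import Relation.Nullary.Decidable using (toSum)
  open import Relation.Binary.PropositionalEquality
  open Valuations using (n<p^n)
  open Legendre
  open SingleLevel

  ∑-mono-≤ : ∀ N {f g} → (∀ i → f (suc i) ≤ g (suc i)) → ∑ N f ≤ ∑ N g
  ∑-mono-≤ zero    f≤g = z≤n
  ∑-mono-≤ (suc N) f≤g = +-mono-≤ (∑-mono-≤ N f≤g) (f≤g N)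

  telescope : ∀ N (b t c : ℕ → ℕ) → (∀ i → b (suc i) + c i ≤ t (suc i) + c (suc i)) → ∑ N b ≤ ∑ N t + c N
  telescope zero    b t c step = z≤n
  telescope (suc N) b t c step = begin
    ∑ N b + b (suc N)               ≤⟨ +-monoˡ-≤ (b (suc N)) (telescope N b t c step) ⟩
    ∑ N t + c N + b (suc N)         ≡⟨ regroup (∑ N t) (c N) (b (suc N)) ⟩
    ∑ N t + (b (suc N) + c N)       ≤⟨ +-monoʳ-≤ (∑ N t) (step N) ⟩
    ∑ N t + (t (suc N) + c (suc N)) ≡⟨ +-assoc (∑ N t) (t (suc N)) (c (suc N)) ⟨
    ∑ N t + t (suc N) + c (suc N)   ∎
    where
    open ≤-Reasoning
    regroup : ∀ s c b → s + c + b ≡ s + (b + c)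
    regroup = solve-∀

  ≥4 : ∀ {p} → 2 ≤ p → p ≢ 2 → p ≢ 3 → 4 ≤ p
  ≥4 {1}                        (s≤s ()) _ _
  ≥4 {2}                        _ p≢2 _   = contradiction refl p≢2
  ≥4 {3}                        _ _   p≢3 = contradiction refl p≢3
  ≥4 {suc (suc (suc (suc _)))} _ _   _   = s≤s (s≤s (s≤s (s≤s z≤n)))

  3R∣⇒R∣ : ∀ {R x} → 3 * R ∣ x → R ∣ x
  3R∣⇒R∣ = ∣-trans (n∣m*n 3)

  credit : ℕ → ℕ → ℕ → ℕ → ℕ
  credit k m Y X = shared Y k X + shared Y m X

  module Credits (k m n Y : ℕ) (k+m≡n : k + m ≡ n) (2n≡1+Y : 2 * n ≡ suc Y) where

    open LevelAnalysis k m n Y k+m≡n 2n≡1+Y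
    private module Swapped = LevelAnalysis m k n Y (trans (+-comm m k) k+m≡n) 2n≡1+Y

    credit-k : ∀ {X} → X ∣ k → X ∣ Y → 1 ≤ credit k m Y X
    credit-k {X} X∣k X∣Y = subst (_≤ credit k m Y X) (shared-yes X∣k X∣Y) (m≤m+n _ (shared Y m X))

    credit-m : ∀ {X} → X ∣ m → X ∣ Y → 1 ≤ credit k m Y X
    credit-m {X} X∣m X∣Y = subst (_≤ credit k m Y X) (shared-yes X∣m X∣Y) (m≤n+m _ (shared Y k X))

    -- Level 3: if 3 divides k or m the indicator [3 ∣ Y] is paid by issuing credit,
    -- otherwise by the excess at level 3.
    claim-3 : Claim 3 0 (credit k m Y 3)
    claim-3 with toSum (3 ∣? k) | toSum (3 ∣? m)
    ... | inj₁ 3∣k | _        = claim-by 3 (inj₂ ∘ credit-k 3∣k)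
    ... | inj₂ _   | inj₁ 3∣m = claim-by 3 (inj₂ ∘ credit-m 3∣m)
    ... | inj₂ 3∤k | inj₂ 3∤m = claim-by 3 (inj₁ ∘ excess-three 3∤k 3∤m)

    module _ (R : ℕ) .{{_ : NonZero R}} where

      private instance
        3R≢0 : NonZero (3 * R)
        3R≢0 = m*n≢0 3 R

      -- Level 3R (R ≥ 3, used for the powers of 3) receives the credit of level R.
      claim-step : 3 ≤ R → Claim (3 * R) (credit k m Y R) (credit k m Y (3 * R))
      claim-step 3≤R with toSum (R ∣? Y)
      ... | inj₂ R∤Y = subst (λ c → Claim (3 * R) c (credit k m Y (3 * R)))
                         (sym (cong₂ _+_ (shared-∤Y R∤Y) (shared-∤Y R∤Y)))
                         (claim-by (3 * R) (λ 3R∣Y → contradiction (3R∣⇒R∣ 3R∣Y) R∤Y))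
      ... | inj₁ R∣Y with toSum (R ∣? k) | toSum (R ∣? m)
      ...   | inj₁ R∣k | _        = subst₂ (Claim (3 * R))
              (sym (cong₂ _+_ (shared-yes R∣k R∣Y) (shared-no R∤m)))
              (sym (trans (cong (shared Y k (3 * R) +_) (shared-no (R∤m ∘ 3R∣⇒R∣))) (+-identityʳ _)))
              (claim-R∣k,Y R 3≤R R∣k R∣Y)
        where
        R∤m : ¬ R ∣ m
        R∤m R∣m = not-both (≤-trans (s≤s (s≤s z≤n)) 3≤R) R∣k R∣m R∣Y
      -- symmetric to the previous case, with k and m exchanged
      ...   | inj₂ R∤k | inj₁ R∣m = subst₂ _≤_
              (cong₂ _+_ (cong (_+ 𝟙 (3 * R ∣? Y)) (D-sym (3 * R) k m n))
                         (sym (cong₂ _+_ (shared-no R∤k) (shared-yes R∣m R∣Y))))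
              (cong₂ _+_ (F-sym (3 * R) k m n)
                         (sym (cong (_+ shared Y m (3 * R)) (shared-no (R∤k ∘ 3R∣⇒R∣)))))
              (Swapped.claim-R∣k,Y R 3≤R R∣m R∣Y)
      ...   | inj₂ R∤k | inj₂ R∤m = subst (λ c → Claim (3 * R) c (credit k m Y (3 * R)))
              (sym (cong₂ _+_ (shared-no R∤k) (shared-no R∤m)))
              (claim-by (3 * R) (inj₁ ∘ excess-large (3 * R) 4≤3R))
        where
        4≤3R : 4 ≤ 3 * R
        4≤3R = ≤-trans (s≤s (s≤s (s≤s (s≤s z≤n)))) (*-monoʳ-≤ 3 3≤R)

    module _ {p} (p-prime : Prime p) where

      lower upper : ℕ → ℕ
      lower i = D (p ^ i) {{p^i≢0 p-prime i}} k m n + 𝟙 (p ^ i ∣? Y)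
      upper i = F (p ^ i) {{p^i≢0 p-prime i}} k m n

      prime-bound : ∀ N → Y ≤ N → ∑ N lower ≤ ∑ N upper
      prime-bound N Y≤N with p ≟ 3
      ... | no p≢3  = ∑-mono-≤ N λ i → let instance _ = p^i≢0 p-prime (suc i) in
        subst₂ _≤_ (+-identityʳ _) (+-identityʳ _)
          (claim-by (p ^ suc i) λ Q∣Y → inj₁ (excess-large (p ^ suc i) (4≤p^[1+i] i Q∣Y) Q∣Y))
        where
        4≤p^[1+i] : ∀ i → p ^ suc i ∣ Y → 4 ≤ p ^ suc i
        4≤p^[1+i] i p^[1+i]∣Y with p ≟ 2
        ... | yes refl = contradiction (∣-trans (m∣m*n (2 ^ i)) p^[1+i]∣Y) 2∤Y
        ... | no  p≢2  = ≤-trans (≥4 (nonTrivial⇒n>1 p {{prime⇒nonTrivial p-prime}}) p≢2 p≢3)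
                                 (m≤m*n p (p ^ i) {{m^n≢0 p i {{prime⇒nonZero p-prime}}}})
      ... | yes refl = subst (∑ N lower ≤_) (trans (cong (∑ N upper +_) (no-credit N Y≤N)) (+-identityʳ _))
                         (telescope N lower upper carried step)
        where
        carried : ℕ → ℕ
        carried zero    = 0
        carried (suc i) = credit k m Y (3 ^ suc i)
        step : ∀ i → lower (suc i) + carried i ≤ upper (suc i) + carried (suc i)
        step zero    = claim-3
        step (suc i) = claim-step (3 ^ suc i) {{m^n≢0 3 (suc i)}} (*-monoʳ-≤ 3 (m^n>0 3 i))
        no-credit : ∀ N → Y ≤ N → carried N ≡ 0
        no-credit zero    _   = refl
        no-credit (suc N) Y≤N = cong₂ _+_ (shared-∤Y 3^N∤Y) (shared-∤Y 3^N∤Y)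
          where
          3^N∤Y : ¬ 3 ^ suc N ∣ Y
          3^N∤Y 3^N∣Y = <⇒≱ (≤-<-trans Y≤N (n<p^n (suc N))) (∣⇒≤ {{Y≢0}} 3^N∣Y)


module FactorialRatio where

  open import Defs using (numer; denom)
  open import Data.Nat
  open import Data.Nat.Properties
  open import Data.Nat.Divisibility
  open import Data.Nat.Primality
  open import Data.Nat.Tactic.RingSolver using (solve-∀)
  open import Data.List using (List; []; _∷_)
  open import Data.List.Relation.Unary.All using (All; []; _∷_)
  open import Relation.Binary.PropositionalEquality
  open Legendre
  open PrimeBounds

  -- It is Landau's criterion for the factorials (6k)! (6m)! (2n)! z! over
  -- (3k)! (3m)! (3n)! (2k)! (2m)! (z+1)!, with m = n - k and Y = z + 1.
  divides-ℕ : ∀ n k z → k ≤ n → 2 * n ≡ suc (suc z) → suc z * denom n k ∣ numer n k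
  divides-ℕ n k z k≤n 2n≡2+z =
    *-cancelʳ-∣ (z !) {{z !≢0}} (subst₂ _∣_ ∏!-ys ∏!-xs (landau N xs ys xs≤N ys≤N dominated))
    where
    m = n ∸ k
    N = 6 * n
    xs ys : List ℕ
    xs = 6 * k ∷ 6 * m ∷ 2 * n ∷ z ∷ []
    ys = 3 * k ∷ 3 * m ∷ 3 * n ∷ 2 * k ∷ 2 * m ∷ suc z ∷ []
    open Credits k m n (suc z) (m+[n∸m]≡n k≤n) 2n≡2+z

    ∏!-xs : ∏! xs ≡ numer n k * z !
    ∏!-xs = regroup ((6 * k) !) ((6 * m) !) ((2 * n) !) (z !)
      where
      regroup : ∀ a b c d → a * (b * (c * (d * 1))) ≡ a * b * c * d
      regroup = solve-∀

    ∏!-ys : ∏! ys ≡ suc z * denom n k * z !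
    ∏!-ys = regroup ((3 * k) !) ((3 * m) !) ((3 * n) !) ((2 * k) !) ((2 * m) !) (suc z) (z !)
      where
      regroup : ∀ a b c d e y f → a * (b * (c * (d * (e * (y * f * 1))))) ≡ y * (a * b * c * d * e) * f
      regroup = solve-∀

    c*x≤N : ∀ c d {x} → x ≤ n → c * x ≤ (c + d) * n
    c*x≤N c d x≤n = *-mono-≤ (m≤m+n c d) x≤n
    1+z≤N : suc z ≤ N
    1+z≤N = ≤-trans (n≤1+n (suc z)) (subst (_≤ N) 2n≡2+z (c*x≤N 2 4 ≤-refl))
    m≤n = m∸n≤m n k
    xs≤N : All (_≤ N) xs
    xs≤N = c*x≤N 6 0 k≤n ∷ c*x≤N 6 0 m≤n ∷ c*x≤N 2 4 ≤-refl ∷ <⇒≤ 1+z≤N ∷ []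
    ys≤N : All (_≤ N) ys
    ys≤N = c*x≤N 3 3 k≤n ∷ c*x≤N 3 3 m≤n ∷ c*x≤N 3 3 ≤-refl ∷
           c*x≤N 2 4 k≤n ∷ c*x≤N 2 4 m≤n ∷ 1+z≤N ∷ []

    dominated : ∀ p (p-prime : Prime p) → ∑ N (λ i → level-sum p-prime i ys) ≤ ∑ N (λ i → level-sum p-prime i xs)
    dominated p p-prime = begin
      ∑ N (λ i → level-sum p-prime i ys)          ≡⟨ ∑-cong N ys-level ⟩
      ∑ N (λ i → lower p-prime i + z/ i)          ≡⟨ ∑-+ N (lower p-prime) z/ ⟩
      ∑ N (lower p-prime) + ∑ N z/                ≤⟨ +-monoˡ-≤ (∑ N z/) (prime-bound p-prime N 1+z≤N) ⟩
      ∑ N (upper p-prime) + ∑ N z/                ≡⟨ ∑-+ N (upper p-prime) z/ ⟨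
      ∑ N (λ i → upper p-prime i + z/ i)          ≡⟨ ∑-cong N xs-level ⟨
      ∑ N (λ i → level-sum p-prime i xs)          ∎
      where
      open ≤-Reasoning
      z/ : ℕ → ℕ
      z/ i = _/p^_ p-prime z i
      -- ⌊(z+1)/Q⌋ = [Q ∣ z+1] + ⌊z/Q⌋ splits the last denominator term
      ys-level : ∀ i → level-sum p-prime i ys ≡ lower p-prime i + z/ i
      ys-level i = let instance _ = p^i≢0 p-prime i in
        trans (cong (λ s → 3 * k / p ^ i + (3 * m / p ^ i + (3 * n / p ^ i + (2 * k / p ^ i + (2 * m / p ^ i + (s + 0))))))
                    (floor-suc (p ^ i) z))
              (regroup (3 * k / p ^ i) (3 * m / p ^ i) (3 * n / p ^ i) (2 * k / p ^ i) (2 * m / p ^ i)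
                       (𝟙 (p ^ i ∣? suc z)) (z / p ^ i))
        where
        regroup : ∀ a b c d e u v → a + (b + (c + (d + (e + ((u + v) + 0))))) ≡ a + b + c + d + e + u + v
        regroup = solve-∀
      xs-level : ∀ i → level-sum p-prime i xs ≡ upper p-prime i + z/ i
      xs-level i = let instance _ = p^i≢0 p-prime i in
        regroup (6 * k / p ^ i) (6 * m / p ^ i) (2 * n / p ^ i) (z / p ^ i)
        where
        regroup : ∀ a b c d → a + (b + (c + (d + 0))) ≡ a + b + c + d
        regroup = solve-∀


open import Defs
open import Data.Nat using (ℕ; _≤_)
open import Data.Integer using (+_; _*_)
open import Data.Integer.Divisibility using (_∣_)

import Data.Nat as ℕ
import Data.Nat.Properties as ℕ
import Data.Nat.Divisibility as ℕ
import Data.Integer as ℤ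
import Data.Integer.Properties as ℤ
open import Relation.Binary.PropositionalEquality using (_≡_; sym; trans; cong; subst)
open FactorialRatio using (divides-ℕ)

-- In ℤ divisibility compares absolute values, and |2n - 1| = 2n - 1 for n ≥ 1;
-- for n = 0 both sides have absolute value 1.
lemma2 : (n k : ℕ) → k ≤ n → (twoNMinusOne n * + denom n k) ∣ (+ numer n k)
lemma2 ℕ.zero    .ℕ.zero ℕ.z≤n = ℕ.∣-refl
lemma2 (ℕ.suc n) k       k≤1+n =
  subst (ℕ._∣ numer (ℕ.suc n) k) (sym |2n-1|*denom) (divides-ℕ (ℕ.suc n) k (2 ℕ.* n) k≤1+n (ℕ.*-suc 2 n))
  where
  |2n-1|*denom : ℤ.∣ twoNMinusOne (ℕ.suc n) * + denom (ℕ.suc n) k ∣ ≡ ℕ.suc (2 ℕ.* n) ℕ.* denom (ℕ.suc n) k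
  |2n-1|*denom = trans (ℤ.abs-* (twoNMinusOne (ℕ.suc n)) (+ denom (ℕ.suc n) k))
                       (cong (ℕ._* denom (ℕ.suc n) k) (ℕ.+-suc n (n ℕ.+ 0)))
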